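{- For every positive integer $n$ and every $\pi\in\Pi(n)$, $|S_{\mathrm{out}}(\pi)| = |S_{\mathrm{in}}(\pi)| = 2^n - n$.
   Context: $\Pi(n)$ denotes the set of permutations of $\{1,\dots,n\}$, each regarded as a sequence $\pi=(\pi_1,\dots,\pi_n)$. A TDRL operation on $\pi$ is specified by a binary pattern $b\in\{0,1\}^n$. Its result is the concatenation of the subsequence $(\pi_i : b_i=1)$ with the subsequence $(\pi_i : b_i=0)$, each taken with indices in increasing order. Write $\pi\to\rho$ if $\rho$ is the result of some TDRL operation on $\pi$. Define $S_{\mathrm{out}}(\pi)=\{\rho:\pi\to\rho\}$ and $S_{\mathrm{in}}(\pi)=\{\rho:\rho\to\pi\}$. -}

module Defs where

open import Data.Nat using (ℕ)
open import Data.Bool using (Bool; true; false; not)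
open import Data.Fin using (Fin)
open import Data.List using (List; []; _∷_; _++_; length; allFin)
open import Data.Vec using (Vec; []; _∷_)
open import Data.Product using (Σ; ∃; _×_)
open import Data.List.Relation.Unary.Unique.Propositional using (Unique)
open import Data.List.Membership.Propositional using (_∈_)
open import Data.List.Relation.Binary.Permutation.Propositional using (_↭_)
open import Function.Bundles using (_⇔_)
open import Relation.Binary.PropositionalEquality using (_≡_)

-- A permutation of {1,…,n} (encoded as Fin n) in one-line notation:
-- a list that is a rearrangement of 0,1,…,n-1.
IsPerm : (n : ℕ) → List (Fin n) → Set
IsPerm n π = π ↭ allFin n

select : ∀ {A : Set} {n : ℕ} → Bool → Vec Bool n → List A → List A
select c [] _ = []
select c (_ ∷ _) [] = []
select c (b ∷ bs) (x ∷ xs) with b | c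
... | true  | true  = x ∷ select c bs xs
... | false | false = x ∷ select c bs xs
... | true  | false = select c bs xs
... | false | true  = select c bs xs

tdrl : ∀ {A : Set} {n : ℕ} → Vec Bool n → List A → List A
tdrl b π = select true b π ++ select false b π

_⟶_ : ∀ {n : ℕ} → List (Fin n) → List (Fin n) → Set
_⟶_ {n} π ρ = Σ (Vec Bool n) (λ b → tdrl b π ≡ ρ)

Sout : ∀ {n : ℕ} → List (Fin n) → List (Fin n) → Set
Sout {n} π ρ = IsPerm n ρ × (π ⟶ ρ)

Sin : ∀ {n : ℕ} → List (Fin n) → List (Fin n) → Set
Sin {n} π ρ = IsPerm n ρ × (ρ ⟶ π)

HasCard : ∀ {A : Set} → (A → Set) → ℕ → Set
HasCard {A} P k = Σ (List A) (λ xs → Unique xs × (length xs ≡ k) × (∀ x → (x ∈ xs) ⇔ P x))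

module Submission where

-- A pattern b ∈ {0,1}ⁿ is sorted if it has the shape 1ᵏ0ⁿ⁻ᵏ; the n + 1
-- sorted patterns all act as the identity.  The key fact is a collision
-- lemma: on a duplicate-free list, two patterns give the same result only if
-- they are equal or both sorted.  So the 2ⁿ patterns produce 2ⁿ - (n + 1) + 1
-- = 2ⁿ - n distinct results, which counts S_out(π).  For S_in(π), tdrl b has
-- a two-sided inverse untdrl b on lists of length n, so S_in(π) is the image
-- of b ↦ untdrl b π, whose collisions reduce to those of tdrl on untdrl b π.

open import Defs
open import Data.Nat using (ℕ; zero; suc; _+_; _≤_; _∸_; _^_; _⊓_)
open import Data.Nat.Properties using (suc-injective; +-suc; +-identityʳ; m≤m+n; m≤n⇒m⊓n≡m; m+n∸m≡n)
open import Data.Nat.Solver using (module +-*-Solver)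
open import Data.Bool using (Bool; true; false)
open import Data.Fin using (Fin)
open import Data.List using (List; []; _∷_; _++_; length; map; take; drop)
import Data.List.Properties as List
open import Data.Vec using (Vec; []; _∷_)
open import Data.Vec.Properties using (∷-injective)
open import Data.Product using (_×_; _,_; proj₁; proj₂; ∃)
open import Data.Sum as Sum using (_⊎_; inj₁; inj₂)
open import Data.Empty using (⊥; ⊥-elim)
open import Function.Bundles using (_⇔_; mk⇔)
import Function.Properties.Equivalence as ⇔
open import Relation.Binary.PropositionalEquality
open import Data.List.Membership.Propositional using (_∈_; _∉_)
open import Data.List.Membership.Propositional.Properties using (∈-map⁺; ∈-map⁻; ∈-++⁺ˡ; ∈-++⁺ʳ; ∈-++⁻)
open import Data.List.Relation.Unary.Any using (here; there)
open import Data.List.Relation.Unary.All as All using ()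
open import Data.List.Relation.Unary.AllPairs using ([]; _∷_)
open import Data.List.Relation.Unary.Unique.Propositional using (Unique)
open import Data.List.Relation.Unary.Unique.Propositional.Properties
  using (++⁺; map⁺; allFin⁺; Unique[x∷xs]⇒x∉xs)
open import Data.List.Relation.Binary.Permutation.Propositional using (_↭_; prep; ↭-trans; ↭-sym; ↭-refl; ↭⇒↭ₛ)
open import Data.List.Relation.Binary.Permutation.Propositional.Properties using (shift; ↭-length)
import Data.List.Relation.Binary.Permutation.Setoid.Properties as Perm

allFalse : ∀ {n} → Vec Bool n → Bool
allFalse [] = true
allFalse (true ∷ _) = false
allFalse (false ∷ bs) = allFalse bs

sorted : ∀ {n} → Vec Bool n → Bool
sorted [] = true
sorted (true ∷ bs) = sorted bs
sorted (false ∷ bs) = allFalse bs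

ones : ∀ n → Vec Bool n
ones zero = []
ones (suc n) = true ∷ ones n

sorted-ones : ∀ n → sorted (ones n) ≡ true
sorted-ones zero = refl
sorted-ones (suc n) = sorted-ones n

-- Two patterns have the same effect on duplicate-free lists exactly when
-- they are equal or both sorted (see tdrl-collision and tdrl-sorted).
SameEffect : ∀ {n} → Vec Bool n → Vec Bool n → Set
SameEffect b b' = b ≡ b' ⊎ (sorted b ≡ true × sorted b' ≡ true)

module _ {A : Set} where

  select-⊆ : ∀ {n} c (b : Vec Bool n) (π : List A) {y} → y ∈ select c b π → y ∈ π
  select-⊆ c [] π ()
  select-⊆ c (_ ∷ _) [] ()
  select-⊆ true (true ∷ bs) (x ∷ xs) (here p) = here p
  select-⊆ true (true ∷ bs) (x ∷ xs) (there m) = there (select-⊆ true bs xs m)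
  select-⊆ false (false ∷ bs) (x ∷ xs) (here p) = here p
  select-⊆ false (false ∷ bs) (x ∷ xs) (there m) = there (select-⊆ false bs xs m)
  select-⊆ true (false ∷ bs) (x ∷ xs) m = there (select-⊆ true bs xs m)
  select-⊆ false (true ∷ bs) (x ∷ xs) m = there (select-⊆ false bs xs m)

  tdrl-↭ : ∀ {n} (b : Vec Bool n) (π : List A) → length π ≡ n → tdrl b π ↭ π
  tdrl-↭ [] [] _ = ↭-refl
  tdrl-↭ (true ∷ bs) (x ∷ π) e = prep x (tdrl-↭ bs π (suc-injective e))
  tdrl-↭ (false ∷ bs) (x ∷ π) e =
    ↭-trans (shift x (select true bs π) (select false bs π)) (prep x (tdrl-↭ bs π (suc-injective e)))

  select-allFalse : ∀ {n} (b : Vec Bool n) (π : List A) → length π ≡ n → allFalse b ≡ true →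
    select true b π ≡ [] × select false b π ≡ π
  select-allFalse [] [] _ _ = refl , refl
  select-allFalse (false ∷ bs) (x ∷ π) e a =
    let front , back = select-allFalse bs π (suc-injective e) a in front , cong (x ∷_) back

  select-true-empty : ∀ {n} (b : Vec Bool n) (π : List A) → length π ≡ n → select true b π ≡ [] →
    allFalse b ≡ true × select false b π ≡ π
  select-true-empty [] [] _ _ = refl , refl
  select-true-empty (false ∷ bs) (x ∷ π) e s =
    let zero-pattern , back = select-true-empty bs π (suc-injective e) s in zero-pattern , cong (x ∷_) back

  tdrl-sorted : ∀ {n} (b : Vec Bool n) (π : List A) → length π ≡ n → sorted b ≡ true → tdrl b π ≡ π
  tdrl-sorted [] [] _ _ = refl
  tdrl-sorted (true ∷ bs) (x ∷ π) e s = cong (x ∷_) (tdrl-sorted bs π (suc-injective e) s)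
  tdrl-sorted (false ∷ bs) (x ∷ π) e s
    with front , back ← select-allFalse bs π (suc-injective e) s
    rewrite front | back = refl

module _ {A : Set} where

  prefix-cancel : ∀ {x : A} xs ys {zs ws} → x ∉ xs → x ∉ ys → xs ++ x ∷ zs ≡ ys ++ x ∷ ws → xs ≡ ys
  prefix-cancel [] [] _ _ _ = refl
  prefix-cancel [] (y ∷ ys) _ x∉ys e = ⊥-elim (x∉ys (here (proj₁ (List.∷-injective e))))
  prefix-cancel (y ∷ xs) [] x∉xs _ e = ⊥-elim (x∉xs (here (sym (proj₁ (List.∷-injective e)))))
  prefix-cancel (y ∷ xs) (y' ∷ ys) x∉xs x∉ys e with List.∷-injective e
  ... | refl , e' = cong (y ∷_) (prefix-cancel xs ys (λ m → x∉xs (there m)) (λ m → x∉ys (there m)) e')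

  select-true-injective : ∀ {n} (b b' : Vec Bool n) (π : List A) → length π ≡ n → Unique π →
    select true b π ≡ select true b' π → b ≡ b'
  select-true-injective [] [] [] _ _ _ = refl
  select-true-injective (true ∷ bs) (true ∷ bs') (x ∷ π) e (_ ∷ u) s =
    cong (true ∷_) (select-true-injective bs bs' π (suc-injective e) u (proj₂ (List.∷-injective s)))
  select-true-injective (false ∷ bs) (false ∷ bs') (x ∷ π) e (_ ∷ u) s =
    cong (false ∷_) (select-true-injective bs bs' π (suc-injective e) u s)
  select-true-injective (true ∷ bs) (false ∷ bs') (x ∷ π) e u s =
    ⊥-elim (Unique[x∷xs]⇒x∉xs u (select-⊆ true bs' π (subst (x ∈_) s (here refl))))
  select-true-injective (false ∷ bs) (true ∷ bs') (x ∷ π) e u s =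
    ⊥-elim (Unique[x∷xs]⇒x∉xs u (select-⊆ true bs π (subst (x ∈_) (sym s) (here refl))))

  zero-head-stays-in-front : ∀ {n} (b : Vec Bool n) x (π : List A) {ys} → length π ≡ n → x ∉ π →
    x ∷ ys ≡ tdrl (false ∷ b) (x ∷ π) → allFalse b ≡ true × ys ≡ π
  zero-head-stays-in-front b x π {ys} e x∉π t = zero-pattern , tail-kept
    where
    front-empty : select true b π ≡ []
    front-empty = sym (prefix-cancel [] (select true b π) (λ ()) (λ m → x∉π (select-⊆ true b π m)) t)
    zero-pattern : allFalse b ≡ true
    zero-pattern = proj₁ (select-true-empty b π e front-empty)
    tail-kept : ys ≡ π
    tail-kept = begin
      ys                     ≡⟨ proj₂ (List.∷-injective (trans t (cong (_++ x ∷ select false b π) front-empty))) ⟩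
      select false b π       ≡⟨ proj₂ (select-true-empty b π e front-empty) ⟩
      π                      ∎
      where open ≡-Reasoning

  tdrl-fixed : ∀ {n} (b : Vec Bool n) (π : List A) → length π ≡ n → Unique π → tdrl b π ≡ π → sorted b ≡ true
  tdrl-fixed [] [] _ _ _ = refl
  tdrl-fixed (true ∷ bs) (x ∷ π) e (_ ∷ u) t = tdrl-fixed bs π (suc-injective e) u (proj₂ (List.∷-injective t))
  tdrl-fixed (false ∷ bs) (x ∷ π) e u t =
    proj₁ (zero-head-stays-in-front bs x π (suc-injective e) (Unique[x∷xs]⇒x∉xs u) (sym t))

  -- Patterns starting with 1 and with 0 can only agree if both are sorted:
  -- the 0-pattern must keep the head in front, so it is 0ⁿ⁺¹, and then the
  -- 1-pattern acts as the identity.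
  head-moved-collision : ∀ {n} (b b' : Vec Bool n) x (π : List A) → length π ≡ n → Unique (x ∷ π) →
    tdrl (true ∷ b) (x ∷ π) ≡ tdrl (false ∷ b') (x ∷ π) → sorted b ≡ true × allFalse b' ≡ true
  head-moved-collision b b' x π e u@(_ ∷ u') t =
    let zero-pattern , fixed = zero-head-stays-in-front b' x π e (Unique[x∷xs]⇒x∉xs u) t
    in tdrl-fixed b π e u' fixed , zero-pattern

  tdrl-collision : ∀ {n} (b b' : Vec Bool n) (π : List A) → length π ≡ n → Unique π →
    tdrl b π ≡ tdrl b' π → SameEffect b b'
  tdrl-collision [] [] [] _ _ _ = inj₁ refl
  tdrl-collision (true ∷ bs) (true ∷ bs') (x ∷ π) e (_ ∷ u) t =
    Sum.map₁ (cong (true ∷_)) (tdrl-collision bs bs' π (suc-injective e) u (proj₂ (List.∷-injective t)))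
  tdrl-collision (false ∷ bs) (false ∷ bs') (x ∷ π) e u@(_ ∷ u') t =
    inj₁ (cong (false ∷_) (select-true-injective bs bs' π (suc-injective e) u'
      (prefix-cancel (select true bs π) (select true bs' π) (fresh bs) (fresh bs') t)))
    where
    fresh : ∀ c → x ∉ select true c π
    fresh c m = Unique[x∷xs]⇒x∉xs u (select-⊆ true c π m)
  tdrl-collision (true ∷ bs) (false ∷ bs') (x ∷ π) e u t =
    inj₂ (head-moved-collision bs bs' x π (suc-injective e) u t)
  tdrl-collision (false ∷ bs) (true ∷ bs') (x ∷ π) e u t =
    let s' , s = head-moved-collision bs' bs x π (suc-injective e) u (sym t) in inj₂ (s , s')

#1 : ∀ {n} → Vec Bool n → ℕ
#1 [] = 0
#1 (true ∷ bs) = suc (#1 bs)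
#1 (false ∷ bs) = #1 bs

#0 : ∀ {n} → Vec Bool n → ℕ
#0 [] = 0
#0 (true ∷ bs) = #0 bs
#0 (false ∷ bs) = suc (#0 bs)

#1+#0 : ∀ {n} (b : Vec Bool n) → #1 b + #0 b ≡ n
#1+#0 [] = refl
#1+#0 (true ∷ bs) = cong suc (#1+#0 bs)
#1+#0 (false ∷ bs) = trans (+-suc (#1 bs) (#0 bs)) (cong suc (#1+#0 bs))

module _ {A : Set} where

  merge : ∀ {n} → Vec Bool n → List A → List A → List A
  merge [] _ _ = []
  merge (true ∷ bs) (a ∷ as) cs = a ∷ merge bs as cs
  merge (true ∷ bs) [] cs = []
  merge (false ∷ bs) as (c ∷ cs) = c ∷ merge bs as cs
  merge (false ∷ bs) as [] = []

  select-merge : ∀ {n} (b : Vec Bool n) (as cs : List A) → length as ≡ #1 b → length cs ≡ #0 b →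
    select true b (merge b as cs) ≡ as × select false b (merge b as cs) ≡ cs
  select-merge [] [] [] _ _ = refl , refl
  select-merge (true ∷ bs) (a ∷ as) cs ea ec =
    let front , back = select-merge bs as cs (suc-injective ea) ec in cong (a ∷_) front , back
  select-merge (false ∷ bs) as (c ∷ cs) ea ec =
    let front , back = select-merge bs as cs ea (suc-injective ec) in front , cong (c ∷_) back

  length-merge : ∀ {n} (b : Vec Bool n) (as cs : List A) → length as ≡ #1 b → length cs ≡ #0 b →
    length (merge b as cs) ≡ n
  length-merge [] [] [] _ _ = refl
  length-merge (true ∷ bs) (a ∷ as) cs ea ec = cong suc (length-merge bs as cs (suc-injective ea) ec)
  length-merge (false ∷ bs) as (c ∷ cs) ea ec = cong suc (length-merge bs as cs ea (suc-injective ec))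

  merge-select : ∀ {n} (b : Vec Bool n) (ρ : List A) → length ρ ≡ n →
    merge b (select true b ρ) (select false b ρ) ≡ ρ
  merge-select [] [] _ = refl
  merge-select (true ∷ bs) (x ∷ ρ) e = cong (x ∷_) (merge-select bs ρ (suc-injective e))
  merge-select (false ∷ bs) (x ∷ ρ) e = cong (x ∷_) (merge-select bs ρ (suc-injective e))

  length-select-true : ∀ {n} (b : Vec Bool n) (ρ : List A) → length ρ ≡ n → length (select true b ρ) ≡ #1 b
  length-select-true [] [] _ = refl
  length-select-true (true ∷ bs) (x ∷ ρ) e = cong suc (length-select-true bs ρ (suc-injective e))
  length-select-true (false ∷ bs) (x ∷ ρ) e = length-select-true bs ρ (suc-injective e)

  take-++ : ∀ (xs ys : List A) → take (length xs) (xs ++ ys) ≡ xs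
  take-++ [] ys = refl
  take-++ (x ∷ xs) ys = cong (x ∷_) (take-++ xs ys)

  drop-++ : ∀ (xs ys : List A) → drop (length xs) (xs ++ ys) ≡ ys
  drop-++ [] ys = refl
  drop-++ (x ∷ xs) ys = drop-++ xs ys

  untdrl : ∀ {n} → Vec Bool n → List A → List A
  untdrl b π = merge b (take (#1 b) π) (drop (#1 b) π)

  split-lengths : ∀ {n} (b : Vec Bool n) (π : List A) → length π ≡ n →
    length (take (#1 b) π) ≡ #1 b × length (drop (#1 b) π) ≡ #0 b
  split-lengths b π e = front , back
    where
    open ≡-Reasoning
    length-π : length π ≡ #1 b + #0 b
    length-π = trans e (sym (#1+#0 b))
    front : length (take (#1 b) π) ≡ #1 b
    front = begin
      length (take (#1 b) π)       ≡⟨ List.length-take (#1 b) π ⟩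
      #1 b ⊓ length π              ≡⟨ m≤n⇒m⊓n≡m (subst (#1 b ≤_) (sym length-π) (m≤m+n (#1 b) (#0 b))) ⟩
      #1 b                         ∎
    back : length (drop (#1 b) π) ≡ #0 b
    back = begin
      length (drop (#1 b) π)       ≡⟨ List.length-drop (#1 b) π ⟩
      length π ∸ #1 b              ≡⟨ cong (_∸ #1 b) length-π ⟩
      #1 b + #0 b ∸ #1 b           ≡⟨ m+n∸m≡n (#1 b) (#0 b) ⟩
      #0 b                         ∎

  length-untdrl : ∀ {n} (b : Vec Bool n) (π : List A) → length π ≡ n → length (untdrl b π) ≡ n
  length-untdrl b π e = let front , back = split-lengths b π e in length-merge b _ _ front back

  tdrl-untdrl : ∀ {n} (b : Vec Bool n) (π : List A) → length π ≡ n → tdrl b (untdrl b π) ≡ π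
  tdrl-untdrl b π e = begin
    tdrl b (untdrl b π)                     ≡⟨ cong₂ _++_ (proj₁ pieces) (proj₂ pieces) ⟩
    take (#1 b) π ++ drop (#1 b) π          ≡⟨ List.take++drop≡id (#1 b) π ⟩
    π                                       ∎
    where
    open ≡-Reasoning
    pieces : select true b (untdrl b π) ≡ take (#1 b) π × select false b (untdrl b π) ≡ drop (#1 b) π
    pieces = let front , back = split-lengths b π e in select-merge b _ _ front back

  untdrl-tdrl : ∀ {n} (b : Vec Bool n) (ρ : List A) → length ρ ≡ n → untdrl b (tdrl b ρ) ≡ ρ
  untdrl-tdrl b ρ e = begin
    merge b (take (#1 b) (front ++ back)) (drop (#1 b) (front ++ back))
      ≡⟨ cong (λ k → merge b (take k (front ++ back)) (drop k (front ++ back))) (sym (length-select-true b ρ e)) ⟩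
    merge b (take (length front) (front ++ back)) (drop (length front) (front ++ back))
      ≡⟨ cong₂ (merge b) (take-++ front back) (drop-++ front back) ⟩
    merge b front back
      ≡⟨ merge-select b ρ e ⟩
    ρ ∎
    where
    open ≡-Reasoning
    front back : List A
    front = select true b ρ
    back = select false b ρ

branch : ∀ {n} → List (Vec Bool n) → List (Vec Bool n) → List (Vec Bool (suc n))
branch X Y = map (true ∷_) X ++ map (false ∷_) Y

module _ {n : ℕ} (X Y : List (Vec Bool n)) where

  branch-∈-true : ∀ {b} → b ∈ X → (true ∷ b) ∈ branch X Y
  branch-∈-true m = ∈-++⁺ˡ (∈-map⁺ (true ∷_) m)

  branch-∈-false : ∀ {b} → b ∈ Y → (false ∷ b) ∈ branch X Y
  branch-∈-false m = ∈-++⁺ʳ (map (true ∷_) X) (∈-map⁺ (false ∷_) m)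

  branch-∈⁻ : ∀ {c b} → (c ∷ b) ∈ branch X Y → (c ≡ true × b ∈ X) ⊎ (c ≡ false × b ∈ Y)
  branch-∈⁻ m with ∈-++⁻ (map (true ∷_) X) m
  ... | inj₁ m' with _ , m'' , refl ← ∈-map⁻ (true ∷_) m' = inj₁ (refl , m'')
  ... | inj₂ m' with _ , m'' , refl ← ∈-map⁻ (false ∷_) m' = inj₂ (refl , m'')

  branch-unique : Unique X → Unique Y → Unique (branch X Y)
  branch-unique uX uY = ++⁺ (map⁺ tail-injective uX) (map⁺ tail-injective uY) disjoint
    where
    tail-injective : ∀ {c} {b b' : Vec Bool n} → c ∷ b ≡ c ∷ b' → b ≡ b'
    tail-injective e = proj₂ (∷-injective e)
    disjoint : ∀ {w} → w ∈ map (true ∷_) X × w ∈ map (false ∷_) Y → ⊥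
    disjoint (m , m') with ∈-map⁻ (true ∷_) m | ∈-map⁻ (false ∷_) m'
    ... | _ , _ , refl | _ , _ , ()

  length-branch : length (branch X Y) ≡ length X + length Y
  length-branch = trans (List.length-++ (map (true ∷_) X))
                        (cong₂ _+_ (List.length-map (true ∷_) X) (List.length-map (false ∷_) Y))

patterns : ∀ n → List (Vec Bool n)
patterns zero = [] ∷ []
patterns (suc n) = branch (patterns n) (patterns n)

nonzero : ∀ n → List (Vec Bool n)
nonzero zero = []
nonzero (suc n) = branch (patterns n) (nonzero n)

unsorted : ∀ n → List (Vec Bool n)
unsorted zero = []
unsorted (suc n) = branch (unsorted n) (nonzero n)

patterns-complete : ∀ {n} (b : Vec Bool n) → b ∈ patterns n
patterns-complete [] = here refl
patterns-complete {suc n} (true ∷ bs) = branch-∈-true (patterns n) (patterns n) (patterns-complete bs)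
patterns-complete {suc n} (false ∷ bs) = branch-∈-false (patterns n) (patterns n) (patterns-complete bs)

nonzero-sound : ∀ {n} (b : Vec Bool n) → b ∈ nonzero n → allFalse b ≡ false
nonzero-sound {suc n} (c ∷ bs) m with branch-∈⁻ (patterns n) (nonzero n) m
... | inj₁ (refl , _) = refl
... | inj₂ (refl , m') = nonzero-sound bs m'

nonzero-complete : ∀ {n} (b : Vec Bool n) → allFalse b ≡ false → b ∈ nonzero n
nonzero-complete {suc n} (true ∷ bs) _ = branch-∈-true (patterns n) (nonzero n) (patterns-complete bs)
nonzero-complete {suc n} (false ∷ bs) a = branch-∈-false (patterns n) (nonzero n) (nonzero-complete bs a)

unsorted-sound : ∀ {n} (b : Vec Bool n) → b ∈ unsorted n → sorted b ≡ false
unsorted-sound {suc n} (c ∷ bs) m with branch-∈⁻ (unsorted n) (nonzero n) m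
... | inj₁ (refl , m') = unsorted-sound bs m'
... | inj₂ (refl , m') = nonzero-sound bs m'

unsorted-complete : ∀ {n} (b : Vec Bool n) → sorted b ≡ false → b ∈ unsorted n
unsorted-complete {suc n} (true ∷ bs) s = branch-∈-true (unsorted n) (nonzero n) (unsorted-complete bs s)
unsorted-complete {suc n} (false ∷ bs) a = branch-∈-false (unsorted n) (nonzero n) (nonzero-complete bs a)

patterns-unique : ∀ n → Unique (patterns n)
patterns-unique zero = All.[] ∷ []
patterns-unique (suc n) = branch-unique (patterns n) (patterns n) (patterns-unique n) (patterns-unique n)

nonzero-unique : ∀ n → Unique (nonzero n)
nonzero-unique zero = []
nonzero-unique (suc n) = branch-unique (patterns n) (nonzero n) (patterns-unique n) (nonzero-unique n)

unsorted-unique : ∀ n → Unique (unsorted n)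
unsorted-unique zero = []
unsorted-unique (suc n) = branch-unique (unsorted n) (nonzero n) (unsorted-unique n) (nonzero-unique n)

2^suc : ∀ n → 2 ^ suc n ≡ 2 ^ n + 2 ^ n
2^suc n = cong (2 ^ n +_) (+-identityʳ (2 ^ n))

length-patterns : ∀ n → length (patterns n) ≡ 2 ^ n
length-patterns zero = refl
length-patterns (suc n) = begin
  length (patterns (suc n))                    ≡⟨ length-branch (patterns n) (patterns n) ⟩
  length (patterns n) + length (patterns n)    ≡⟨ cong₂ _+_ (length-patterns n) (length-patterns n) ⟩
  2 ^ n + 2 ^ n                                ≡⟨ sym (2^suc n) ⟩
  2 ^ suc n                                    ∎
  where open ≡-Reasoning

length-nonzero : ∀ n → suc (length (nonzero n)) ≡ 2 ^ n
length-nonzero zero = refl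
length-nonzero (suc n) = begin
  suc (length (nonzero (suc n)))               ≡⟨ cong suc (length-branch (patterns n) (nonzero n)) ⟩
  suc (length (patterns n) + length (nonzero n)) ≡⟨ sym (+-suc (length (patterns n)) (length (nonzero n))) ⟩
  length (patterns n) + suc (length (nonzero n)) ≡⟨ cong₂ _+_ (length-patterns n) (length-nonzero n) ⟩
  2 ^ n + 2 ^ n                                ≡⟨ sym (2^suc n) ⟩
  2 ^ suc n                                    ∎
  where open ≡-Reasoning

length-unsorted : ∀ n → n + suc (length (unsorted n)) ≡ 2 ^ n
length-unsorted zero = refl
length-unsorted (suc n) = begin
  suc n + suc (length (unsorted (suc n)))      ≡⟨ cong (λ k → suc n + suc k) (length-branch (unsorted n) (nonzero n)) ⟩
  suc n + suc (u + z)                          ≡⟨ solve 3 (λ n u z → con 1 :+ n :+ (con 1 :+ (u :+ z))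
                                                              := (n :+ (con 1 :+ u)) :+ (con 1 :+ z)) refl n u z ⟩
  (n + suc u) + suc z                          ≡⟨ cong₂ _+_ (length-unsorted n) (length-nonzero n) ⟩
  2 ^ n + 2 ^ n                                ≡⟨ sym (2^suc n) ⟩
  2 ^ suc n                                    ∎
  where
  open ≡-Reasoning
  open +-*-Solver
  u = length (unsorted n)
  z = length (nonzero n)

count-unsorted : ∀ n → 2 ^ n ∸ n ≡ suc (length (unsorted n))
count-unsorted n = trans (cong (_∸ n) (sym (length-unsorted n))) (m+n∸m≡n n (suc (length (unsorted n))))

HasCard-resp-⇔ : ∀ {A : Set} {P Q : A → Set} {k} → (∀ x → P x ⇔ Q x) → HasCard P k → HasCard Q k
HasCard-resp-⇔ P⇔Q (xs , unique , len , members) = xs , unique , len , λ x → ⇔.trans (members x) (P⇔Q x)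

map-unique-on : ∀ {B C : Set} (f : B → C) (xs : List B) →
  (∀ {x y} → x ∈ xs → y ∈ xs → f x ≡ f y → x ≡ y) → Unique xs → Unique (map f xs)
map-unique-on f [] _ [] = []
map-unique-on f (x ∷ xs) injective (x-fresh ∷ u) =
  All.tabulate (λ m e → let _ , my , e' = ∈-map⁻ f m in
                 All.lookup x-fresh my (injective (here refl) (there my) (trans e e')))
  ∷ map-unique-on f xs (λ m m' → injective (there m) (there m')) u

unsorted-not-sorted : ∀ {n} {b : Vec Bool n} → b ∈ unsorted n → sorted b ≡ true → ⊥
unsorted-not-sorted {b = b} m s with trans (sym s) (unsorted-sound b m)
... | ()

-- If f sends all sorted patterns to x₀ and identifies two patterns only when
-- they have the same effect, its image is x₀ together with the distinct
-- images of the unsorted patterns: 2ⁿ - n values.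
module _ {X : Set} {n : ℕ} (f : Vec Bool n → X) (x₀ : X)
         (sorted-to-x₀ : ∀ b → sorted b ≡ true → f b ≡ x₀)
         (collision : ∀ b b' → f b ≡ f b' → SameEffect b b') where

  unsorted-rigid : ∀ {b b'} → b ∈ unsorted n → f b ≡ f b' → b ≡ b'
  unsorted-rigid {b} {b'} m e with collision b b' e
  ... | inj₁ b≡b' = b≡b'
  ... | inj₂ (s , _) = ⊥-elim (unsorted-not-sorted m s)

  x₀-not-unsorted : x₀ ∉ map f (unsorted n)
  x₀-not-unsorted m with b , mb , x₀≡fb ← ∈-map⁻ f m
    with refl ← unsorted-rigid mb (trans (sym x₀≡fb) (sym (sorted-to-x₀ (ones n) (sorted-ones n))))
    = unsorted-not-sorted mb (sorted-ones n)

  image-card : HasCard (λ x → ∃ λ b → f b ≡ x) (2 ^ n ∸ n)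
  image-card = x₀ ∷ map f (unsorted n) , unique , len , λ x → mk⇔ (to x) (from x)
    where
    unique : Unique (x₀ ∷ map f (unsorted n))
    unique = All.tabulate (λ m x₀≡x → x₀-not-unsorted (subst (_∈ map f (unsorted n)) (sym x₀≡x) m))
           ∷ map-unique-on f (unsorted n) (λ m _ → unsorted-rigid m) (unsorted-unique n)
    len : suc (length (map f (unsorted n))) ≡ 2 ^ n ∸ n
    len = trans (cong suc (List.length-map f (unsorted n))) (sym (count-unsorted n))
    to : ∀ x → x ∈ x₀ ∷ map f (unsorted n) → ∃ λ b → f b ≡ x
    to x (here refl) = ones n , sorted-to-x₀ (ones n) (sorted-ones n)
    to x (there m) = let b , _ , x≡fb = ∈-map⁻ f m in b , sym x≡fb
    from : ∀ x → (∃ λ b → f b ≡ x) → x ∈ x₀ ∷ map f (unsorted n)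
    from x (b , refl) with sorted b in s
    ... | true = here (sorted-to-x₀ b s)
    ... | false = there (∈-map⁺ f (unsorted-complete b s))

perm-unique : ∀ {n} {ρ : List (Fin n)} → IsPerm n ρ → Unique ρ
perm-unique {n} p = Perm.Unique-resp-↭ (setoid (Fin n)) (↭⇒↭ₛ (↭-sym p)) (allFin⁺ n)

perm-length : ∀ {n} {ρ : List (Fin n)} → IsPerm n ρ → length ρ ≡ n
perm-length p = trans (↭-length p) (List.length-tabulate (λ i → i))

module _ {n : ℕ} (π : List (Fin n)) (p : IsPerm n π) where

  private
    length-π : length π ≡ n
    length-π = perm-length p

  Sout-image : ∀ ρ → (∃ λ b → tdrl b π ≡ ρ) ⇔ Sout π ρ
  Sout-image ρ = mk⇔ (λ { (b , refl) → ↭-trans (tdrl-↭ b π length-π) p , b , refl }) proj₂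

  untdrl-perm : ∀ b → IsPerm n (untdrl b π)
  untdrl-perm b = ↭-trans (↭-sym (subst (_↭ untdrl b π) (tdrl-untdrl b π length-π)
                                         (tdrl-↭ b (untdrl b π) (length-untdrl b π length-π)))) p

  Sin-image : ∀ ρ → (∃ λ b → untdrl b π ≡ ρ) ⇔ Sin π ρ
  Sin-image ρ = mk⇔ to from
    where
    to : (∃ λ b → untdrl b π ≡ ρ) → Sin π ρ
    to (b , e) = subst (Sin π) e (untdrl-perm b , b , tdrl-untdrl b π length-π)
    from : Sin π ρ → ∃ λ b → untdrl b π ≡ ρ
    from (ρ-perm , b , t) = b , (begin
      untdrl b π              ≡⟨ cong (untdrl b) (sym t) ⟩
      untdrl b (tdrl b ρ)     ≡⟨ untdrl-tdrl b ρ (perm-length ρ-perm) ⟩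
      ρ                       ∎)
      where open ≡-Reasoning

  untdrl-sorted : ∀ b → sorted b ≡ true → untdrl b π ≡ π
  untdrl-sorted b s = trans (cong (untdrl b) (sym (tdrl-sorted b π length-π s))) (untdrl-tdrl b π length-π)

  -- If untdrl b π = untdrl b' π = σ then tdrl b σ = π = tdrl b' σ, and σ is
  -- a permutation, so the collision lemma applies to σ.
  untdrl-collision : ∀ b b' → untdrl b π ≡ untdrl b' π → SameEffect b b'
  untdrl-collision b b' e =
    tdrl-collision b b' (untdrl b π) (length-untdrl b π length-π) (perm-unique (untdrl-perm b))
      (trans (tdrl-untdrl b π length-π) (sym (trans (cong (tdrl b') e) (tdrl-untdrl b' π length-π))))

theorem1 : ∀ (n : ℕ) → 1 ≤ n → (π : List (Fin n)) → IsPerm n π →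
    HasCard (Sout π) (2 ^ n ∸ n) × HasCard (Sin π) (2 ^ n ∸ n)
theorem1 n _ π p = HasCard-resp-⇔ (Sout-image π p) out-image , HasCard-resp-⇔ (Sin-image π p) in-image
  where
  out-image : HasCard (λ ρ → ∃ λ b → tdrl b π ≡ ρ) (2 ^ n ∸ n)
  out-image = image-card (λ b → tdrl b π) π (λ b → tdrl-sorted b π (perm-length p))
                         (λ b b' → tdrl-collision b b' π (perm-length p) (perm-unique p))
  in-image : HasCard (λ ρ → ∃ λ b → untdrl b π ≡ ρ) (2 ^ n ∸ n)
  in-image = image-card (λ b → untdrl b π) π (untdrl-sorted π p) (untdrl-collision π p)
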